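{- For every nonnegative integer $g$, the number of numerical semigroups with multiplicity four and genus $g$ equals the number of unordered partitions of $g+6$ into three parts such that the $i$-th part is different from $i$; that is, the number of integer triples $(x,y,z)$ with $0<x\le y\le z$, $x+y+z=g+6$, $x\ne 1$, $y\ne 2$ and $z\ne 3$.
   Context: A numerical semigroup is a submonoid $S$ of $(\mathbb{N},+)$ with $\mathbb{N}\setminus S$ finite. Its multiplicity is its least positive element and its genus is $\#(\mathbb{N}\setminus S)$. An unordered partition of $n$ into three parts is a triple $(p_1,p_2,p_3)$ of positive integers with $p_1\le p_2\le p_3$ and $p_1+p_2+p_3=n$; its $i$-th part is $p_i$. -}

module Defs where

open import Data.Nat using (ℕ; zero; suc; _+_; _≤_)
open import Data.Bool using (Bool; true; false)
open import Data.Product using (Σ; _×_; _,_; ∃)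
open import Relation.Binary.PropositionalEquality using (_≡_; _≢_)

Subset : Set
Subset = ℕ → Bool

record IsNumericalSemigroup (S : Subset) : Set where
  field
    zero∈   : S 0 ≡ true
    closed  : ∀ a b → S a ≡ true → S b ≡ true → S (a + b) ≡ true
    cofinite : ∃ λ N → ∀ n → N ≤ n → S n ≡ true

gapsBelow : Subset → ℕ → ℕ
gapsBelow S zero = 0
gapsBelow S (suc N) with S N
... | true  = gapsBelow S N
... | false = suc (gapsBelow S N)

HasGenus : Subset → ℕ → Set
HasGenus S g = ∃ λ N → (∀ n → N ≤ n → S n ≡ true) × gapsBelow S N ≡ g

HasMultiplicity : Subset → ℕ → Set
HasMultiplicity S m = (0 ≢ m) × (S m ≡ true) × (∀ k → 0 ≢ k → k ≤ m → k ≢ m → S k ≡ false)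

NSm4 : ℕ → Subset → Set
NSm4 g S = IsNumericalSemigroup S × HasMultiplicity S 4 × HasGenus S g

GoodTriple : ℕ → ℕ × ℕ × ℕ → Set
GoodTriple n (x , y , z) =
  (1 ≤ x) × (x ≤ y) × (y ≤ z) × (x + y + z ≡ n) × (x ≢ 1) × (y ≢ 2) × (z ≢ 3)

_≐_ : Subset → Subset → Set
S ≐ T = ∀ n → S n ≡ T n

module Submission where

-- A semigroup S of multiplicity 4 is determined by its Kunz coordinates
-- (a, b, c): the least element of S congruent to r = 1, 2, 3 mod 4 is 4a + 1,
-- 4b + 2, 4c + 3 respectively.  Closure under addition amounts to the Kunz
-- inequalities b ≤ 2a, b ≤ 2c + 1, c ≤ a + b, a ≤ b + c + 1, and the genus is
-- a + b + c.  So semigroups of genus g correspond to positive solutions of the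
-- Kunz inequalities with a + b + c = g ('kunz-NSm4', 'kunz-injective',
-- 'semigroup-kunz').  Such a solution corresponds to the good triple
-- (a − L + 2, b + 2, L + c + 2), where L = max(⌈b/2⌉, ⌈(a + c − b)/2⌉) is the
-- least L with b ≤ 2L and a + c ≤ 2L + b: this relation is total and
-- single-valued in both directions ('toTriple', 'toKunz',
-- 'corresponds-functional', 'corresponds-injective').

open import Defs
open import Data.Nat
open import Data.Nat.Properties
open import Data.Nat.DivMod using (_/_; _%_; m≡m%n+[m/n]*n; m%n<n)
open import Data.Nat.Tactic.RingSolver
open import Data.Bool using (Bool; true; false)
import Data.Bool as Bool
open import Data.Bool.Properties using (¬-not)
open import Data.Product using (Σ; _×_; _,_; ∃; proj₁; proj₂)
open import Data.Sum using (_⊎_; inj₁; inj₂)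
open import Data.List using (_∷_; [])
open import Relation.Binary.PropositionalEquality
open import Relation.Nullary using (¬_; yes; no; Dec; contradiction; _×-dec_; ¬?)
open import Relation.Nullary.Decidable using (map′)
open import Algebra.Properties.CommutativeSemigroup +-commutativeSemigroup using (interchange; x∙yz≈y∙xz)

-- Linear arithmetic by certificate: to prove L ≤ R, add hypotheses up to
-- A ≤ B with _⊕_ and let the ring solver check L + B ≡ R + A.
linear : ∀ {L R A B} → A ≤ B → L + B ≡ R + A → L ≤ R
linear {L} {R} {A} A≤B eq = +-cancelʳ-≤ A L R (subst (L + A ≤_) eq (+-monoʳ-≤ L A≤B))

infixr 5 _⊕_
_⊕_ : ∀ {a b c d} → a ≤ b → c ≤ d → a + c ≤ b + d
_⊕_ = +-mono-≤

-- A strict inequality in the additive form the ring solver reads.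
<⇒1+≤ : ∀ {m n} → m < n → 1 + m ≤ n
<⇒1+≤ m<n = m<n

half-≤ : ∀ u v → u + u ≤ v + v + 1 → u ≤ v
half-≤ u v 2u≤2v+1 = ≮⇒≥ λ v<u → contradiction (absurd v<u) λ ()
  where
  absurd : v < u → 1 ≤ 0
  absurd v<u = linear (2u≤2v+1 ⊕ <⇒1+≤ v<u ⊕ <⇒1+≤ v<u) (solve (u ∷ v ∷ []))

half-positive : ∀ {b L} → 1 ≤ b → b ≤ L + L → 1 ≤ L
half-positive {L = zero}  1≤b b≤0 = contradiction (≤-trans 1≤b b≤0) λ ()
half-positive {L = suc L} _   _   = s≤s z≤n

∃-difference : ∀ {m n} → m ≤ n → Σ ℕ λ k → n ≡ k + m
∃-difference {m} {n} m≤n = n ∸ m , sym (m∸n+n≡m m≤n)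

least : (P : ℕ → Set) → (∀ n → Dec (P n)) → ∀ {B} → P B → Σ ℕ λ m → P m × (∀ q → q < m → ¬ P q)
least P P? PB with P? 0
... | yes P0 = 0 , P0 , λ _ ()
least P P? {zero}  PB | no ¬P0 = contradiction PB ¬P0
least P P? {suc B} PB | no ¬P0 with least (λ n → P (suc n)) (λ n → P? (suc n)) PB
... | m , Pm , below = suc m , Pm , below′
  where
  below′ : ∀ q → q < suc m → ¬ P q
  below′ zero    _         = ¬P0
  below′ (suc q) (s≤s q<m) = below q q<m

divMod4 : ∀ n → Σ ℕ λ q → Σ ℕ λ r → r ≤ 3 × n ≡ q * 4 + r
divMod4 n = n / 4 , n % 4 , s≤s⁻¹ (m%n<n n 4) , trans (m≡m%n+[m/n]*n n 4) (+-comm (n % 4) _)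

blocks-+ : ∀ q q′ r r′ → q * 4 + r + (q′ * 4 + r′) ≡ (q + q′) * 4 + (r + r′)
blocks-+ q q′ r r′ =
  trans (interchange (q * 4) r (q′ * 4) r′) (cong (_+ (r + r′)) (sym (*-distribʳ-+ 4 q q′)))

carry : ∀ Q s → Q * 4 + (4 + s) ≡ suc Q * 4 + s
carry Q s = trans (sym (+-assoc (Q * 4) 4 s)) (cong (_+ s) (+-comm (Q * 4) 4))

isZero : ℕ → Bool
isZero zero    = true
isZero (suc _) = false

isZero-∸ : ∀ {m n} → m ≤ n → isZero (m ∸ n) ≡ true
isZero-∸ m≤n rewrite m≤n⇒m∸n≡0 m≤n = refl

isZero-∸⁻¹ : ∀ m n → isZero (m ∸ n) ≡ true → m ≤ n
isZero-∸⁻¹ zero    n       _  = z≤n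
isZero-∸⁻¹ (suc m) (suc n) eq = s≤s (isZero-∸⁻¹ m n eq)

isZero-∸> : ∀ {m n} → n < m → isZero (m ∸ n) ≡ false
isZero-∸> {suc m} {zero}  _         = refl
isZero-∸> {suc m} {suc n} (s≤s n<m) = isZero-∸> n<m

Closed : Subset → Set
Closed S = ∀ m n → S m ≡ true → S n ≡ true → S (m + n) ≡ true

closed-cong : ∀ {S T} → S ≐ T → Closed S → Closed T
closed-cong S≐T closed m n m∈ n∈ =
  trans (sym (S≐T (m + n))) (closed m n (trans (S≐T m) m∈) (trans (S≐T n) n∈))

-- The set with Kunz coordinates (a, b, c): it contains every multiple of 4,
-- and the residue classes 1, 2, 3 mod 4 from 4a + 1, 4b + 2, 4c + 3 on.
kunz : ℕ → ℕ → ℕ → Subset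
kunz a b c 0 = true
kunz a b c 1 = isZero a
kunz a b c 2 = isZero b
kunz a b c 3 = isZero c
kunz a b c (suc (suc (suc (suc n)))) = kunz (a ∸ 1) (b ∸ 1) (c ∸ 1) n

coord : ℕ → ℕ → ℕ → ℕ → ℕ
coord a b c 1 = a
coord a b c 2 = b
coord a b c 3 = c
coord a b c _ = 0

kunz-shift : ∀ q a b c n → kunz a b c (q * 4 + n) ≡ kunz (a ∸ q) (b ∸ q) (c ∸ q) n
kunz-shift zero    a b c n = refl
kunz-shift (suc q) a b c n
  rewrite kunz-shift q (a ∸ 1) (b ∸ 1) (c ∸ 1) n
        | ∸-+-assoc a 1 q | ∸-+-assoc b 1 q | ∸-+-assoc c 1 q = refl

kunz-residue : ∀ a b c q r → r ≤ 3 → kunz a b c (q * 4 + r) ≡ isZero (coord a b c r ∸ q)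
kunz-residue a b c q r r≤3 rewrite kunz-shift q a b c r = at r r≤3
  where
  at : ∀ r → r ≤ 3 → kunz (a ∸ q) (b ∸ q) (c ∸ q) r ≡ isZero (coord a b c r ∸ q)
  at 0 _ rewrite 0∸n≡0 q = refl
  at 1 _ = refl
  at 2 _ = refl
  at 3 _ = refl
  at (suc (suc (suc (suc _)))) (s≤s (s≤s (s≤s ())))

∈kunz : ∀ {a b c r} q → r ≤ 3 → coord a b c r ≤ q → kunz a b c (q * 4 + r) ≡ true
∈kunz {a} {b} {c} {r} q r≤3 le = trans (kunz-residue a b c q r r≤3) (isZero-∸ le)

∈kunz⁻¹ : ∀ {a b c r} q → r ≤ 3 → kunz a b c (q * 4 + r) ≡ true → coord a b c r ≤ q
∈kunz⁻¹ {a} {b} {c} {r} q r≤3 mem =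
  isZero-∸⁻¹ (coord a b c r) q (trans (sym (kunz-residue a b c q r r≤3)) mem)

-- The Kunz inequalities for multiplicity 4.  They express that the sums
-- (4a+1)+(4a+1), (4c+3)+(4c+3), (4a+1)+(4b+2) and (4b+2)+(4c+3) of
-- Apéry elements lie in the set.
KunzIneqs : ℕ → ℕ → ℕ → Set
KunzIneqs a b c = (b ≤ a + a) × (b ≤ c + c + 1) × (c ≤ a + b) × (a ≤ b + c + 1)

module Sufficiency {a b c : ℕ} (b≤2a : b ≤ a + a) (b≤2c+1 : b ≤ c + c + 1)
                               (c≤a+b : c ≤ a + b) (a≤b+c+1 : a ≤ b + c + 1) where

  +1-mono : ∀ {m n} → m ≤ n → m + 1 ≤ suc n
  +1-mono {m} {n} m≤n = subst (_≤ suc n) (+-comm 1 m) (s≤s m≤n)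

  ∈-carry : ∀ {s} Q → s ≤ 3 → coord a b c s ≤ suc Q → kunz a b c (Q * 4 + (4 + s)) ≡ true
  ∈-carry {s} Q s≤3 le = subst (λ n → kunz a b c n ≡ true) (sym (carry Q s)) (∈kunz (suc Q) s≤3 le)

  residue-sum : ∀ q q′ r r′ → r ≤ 3 → r′ ≤ 3 → coord a b c r ≤ q → coord a b c r′ ≤ q′ →
                kunz a b c ((q + q′) * 4 + (r + r′)) ≡ true
  residue-sum q q′ 0 r′ _ r′≤3 _ h′ = ∈kunz (q + q′) r′≤3 (≤-trans h′ (m≤n+m q′ q))
  residue-sum q q′ r 0 r≤3 _ h _ rewrite +-identityʳ r = ∈kunz (q + q′) r≤3 (≤-trans h (m≤m+n q q′))
  residue-sum q q′ 1 1 _ _ h h′ = ∈kunz (q + q′) (s≤s (s≤s z≤n)) (≤-trans b≤2a (h ⊕ h′))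
  residue-sum q q′ 1 2 _ _ h h′ = ∈kunz (q + q′) ≤-refl (≤-trans c≤a+b (h ⊕ h′))
  residue-sum q q′ 2 1 _ _ h h′ = ∈kunz (q + q′) ≤-refl (≤-trans c≤a+b (subst (_≤ q + q′) (+-comm b a) (h ⊕ h′)))
  residue-sum q q′ 1 3 _ _ _ _ = ∈-carry (q + q′) z≤n z≤n
  residue-sum q q′ 2 2 _ _ _ _ = ∈-carry (q + q′) z≤n z≤n
  residue-sum q q′ 3 1 _ _ _ _ = ∈-carry (q + q′) z≤n z≤n
  residue-sum q q′ 2 3 _ _ h h′ = ∈-carry (q + q′) (s≤s z≤n) (≤-trans a≤b+c+1 (+1-mono (h ⊕ h′)))
  residue-sum q q′ 3 2 _ _ h h′ =
    ∈-carry (q + q′) (s≤s z≤n) (≤-trans a≤b+c+1 (+1-mono (subst (_≤ q + q′) (+-comm c b) (h ⊕ h′))))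
  residue-sum q q′ 3 3 _ _ h h′ = ∈-carry (q + q′) (s≤s (s≤s z≤n)) (≤-trans b≤2c+1 (+1-mono (h ⊕ h′)))
  residue-sum _ _ (suc (suc (suc (suc _)))) _ (s≤s (s≤s (s≤s ()))) _ _ _
  residue-sum _ _ _ (suc (suc (suc (suc _)))) _ (s≤s (s≤s (s≤s ()))) _ _

  closed : Closed (kunz a b c)
  closed m n m∈ n∈ with divMod4 m | divMod4 n
  ... | q , r , r≤3 , refl | q′ , r′ , r′≤3 , refl =
    subst (λ k → kunz a b c k ≡ true) (sym (blocks-+ q q′ r r′))
      (residue-sum q q′ r r′ r≤3 r′≤3 (∈kunz⁻¹ q r≤3 m∈) (∈kunz⁻¹ q′ r′≤3 n∈))

-- Conversely, closure under addition forces the Kunz inequalities: each one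
-- is the membership of a sum of two Apéry elements.
module Necessity {a b c : ℕ} (closed : Closed (kunz a b c)) where

  apéry : ∀ r → r ≤ 3 → kunz a b c (coord a b c r * 4 + r) ≡ true
  apéry r r≤3 = ∈kunz (coord a b c r) r≤3 ≤-refl

  apéry-sum : ∀ r r′ → r ≤ 3 → r′ ≤ 3 →
    kunz a b c ((coord a b c r + coord a b c r′) * 4 + (r + r′)) ≡ true
  apéry-sum r r′ r≤3 r′≤3 =
    subst (λ n → kunz a b c n ≡ true) (blocks-+ (coord a b c r) (coord a b c r′) r r′)
      (closed (coord a b c r * 4 + r) (coord a b c r′ * 4 + r′) (apéry r r≤3) (apéry r′ r′≤3))

  carried : ∀ Q s → s ≤ 3 → kunz a b c (Q * 4 + (4 + s)) ≡ true → coord a b c s ≤ Q + 1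
  carried Q s s≤3 mem =
    subst (coord a b c s ≤_) (+-comm 1 Q) (∈kunz⁻¹ (suc Q) s≤3 (subst (λ n → kunz a b c n ≡ true) (carry Q s) mem))

  ineqs : KunzIneqs a b c
  ineqs = ∈kunz⁻¹ (a + a) (s≤s (s≤s z≤n)) (apéry-sum 1 1 (s≤s z≤n) (s≤s z≤n))
        , carried (c + c) 2 (s≤s (s≤s z≤n)) (apéry-sum 3 3 ≤-refl ≤-refl)
        , ∈kunz⁻¹ (a + b) ≤-refl (apéry-sum 1 2 (s≤s z≤n) (s≤s (s≤s z≤n)))
        , carried (b + c) 1 (s≤s z≤n) (apéry-sum 2 3 (s≤s (s≤s z≤n)) ≤-refl)

kunz-all : ∀ n → kunz 0 0 0 n ≡ true
kunz-all 0 = refl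
kunz-all 1 = refl
kunz-all 2 = refl
kunz-all 3 = refl
kunz-all (suc (suc (suc (suc n)))) = kunz-all n

kunz-full : ∀ {a b c} M → a ≤ M → b ≤ M → c ≤ M → ∀ n → M * 4 ≤ n → kunz a b c n ≡ true
kunz-full {a} {b} {c} M a≤M b≤M c≤M n M*4≤n =
  subst (λ k → kunz a b c k ≡ true) (m+[n∸m]≡n M*4≤n) (beyond (n ∸ M * 4))
  where
  beyond : ∀ k → kunz a b c (M * 4 + k) ≡ true
  beyond k rewrite kunz-shift M a b c k
                 | m≤n⇒m∸n≡0 a≤M | m≤n⇒m∸n≡0 b≤M | m≤n⇒m∸n≡0 c≤M = kunz-all k

kunz-multiplicity : ∀ {a b c} → 1 ≤ a → 1 ≤ b → 1 ≤ c → HasMultiplicity (kunz a b c) 4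
kunz-multiplicity {suc a} {suc b} {suc c} _ _ _ = (λ ()) , refl , below
  where
  below : ∀ k → 0 ≢ k → k ≤ 4 → k ≢ 4 → kunz (suc a) (suc b) (suc c) k ≡ false
  below 0 0≢0 _ _ = contradiction refl 0≢0
  below 1 _ _ _ = refl
  below 2 _ _ _ = refl
  below 3 _ _ _ = refl
  below 4 _ _ 4≢4 = contradiction refl 4≢4
  below (suc (suc (suc (suc (suc _))))) _ (s≤s (s≤s (s≤s (s≤s ())))) _

gap : Bool → ℕ
gap true  = 0
gap false = 1

gapsBelow-suc : ∀ S N → gapsBelow S (suc N) ≡ gap (S N) + gapsBelow S N
gapsBelow-suc S N with S N
... | true  = refl
... | false = refl

gapsBelow-front : ∀ S N → gapsBelow S (suc N) ≡ gap (S 0) + gapsBelow (λ n → S (suc n)) N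
gapsBelow-front S zero = gapsBelow-suc S 0
gapsBelow-front S (suc N) = begin
  gapsBelow S (suc (suc N))                      ≡⟨ gapsBelow-suc S (suc N) ⟩
  gap (S (suc N)) + gapsBelow S (suc N)          ≡⟨ cong (gap (S (suc N)) +_) (gapsBelow-front S N) ⟩
  gap (S (suc N)) + (gap (S 0) + gapsBelow S′ N) ≡⟨ x∙yz≈y∙xz (gap (S (suc N))) (gap (S 0)) _ ⟩
  gap (S 0) + (gap (S′ N) + gapsBelow S′ N)      ≡⟨ cong (gap (S 0) +_) (sym (gapsBelow-suc S′ N)) ⟩
  gap (S 0) + gapsBelow S′ (suc N)               ∎
  where
  open ≡-Reasoning
  S′ : Subset
  S′ n = S (suc n)

gapsBelow-cong : ∀ {S T} N → S ≐ T → gapsBelow S N ≡ gapsBelow T N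
gapsBelow-cong zero    S≐T = refl
gapsBelow-cong {S} {T} (suc N) S≐T rewrite gapsBelow-suc S N | gapsBelow-suc T N
  = cong₂ (λ u v → gap u + v) (S≐T N) (gapsBelow-cong N S≐T)

HasGenus-cong : ∀ {S T g} → S ≐ T → HasGenus S g → HasGenus T g
HasGenus-cong S≐T (N , full , gaps≡g) =
  N , (λ n N≤n → trans (sym (S≐T n)) (full n N≤n)) , trans (sym (gapsBelow-cong N S≐T)) gaps≡g

gapsBelow-stable : ∀ S N → (∀ n → N ≤ n → S n ≡ true) → ∀ k → gapsBelow S (k + N) ≡ gapsBelow S N
gapsBelow-stable S N full zero = refl
gapsBelow-stable S N full (suc k)
  rewrite gapsBelow-suc S (k + N) | full (k + N) (m≤n+m N k) = gapsBelow-stable S N full k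

genus-unique : ∀ {S g} N → (∀ n → N ≤ n → S n ≡ true) → HasGenus S g → gapsBelow S N ≡ g
genus-unique {S} {g} N full (N₀ , full₀ , gaps≡g) = begin
  gapsBelow S N         ≡⟨ sym (gapsBelow-stable S N full N₀) ⟩
  gapsBelow S (N₀ + N)  ≡⟨ cong (gapsBelow S) (+-comm N₀ N) ⟩
  gapsBelow S (N + N₀)  ≡⟨ gapsBelow-stable S N₀ full₀ N ⟩
  gapsBelow S N₀        ≡⟨ gaps≡g ⟩
  g                     ∎
  where open ≡-Reasoning

gap-isZero : ∀ a → gap (isZero a) + (a ∸ 1) ≡ a
gap-isZero zero    = refl
gap-isZero (suc a) = refl

-- The gaps of kunz a b c are the 4q + r with q < coord r; there are a + b + c of them.
kunz-genus : ∀ M a b c → a ≤ M → b ≤ M → c ≤ M → gapsBelow (kunz a b c) (M * 4) ≡ a + b + c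
kunz-genus zero    zero zero zero _ _ _ = refl
kunz-genus (suc M) a b c a≤ b≤ c≤ = begin
  gapsBelow K (4 + M * 4)
    ≡⟨ first-block ⟩
  gap (isZero a) + (gap (isZero b) + (gap (isZero c) + gapsBelow K′ (M * 4)))
    ≡⟨ cong (λ n → gap (isZero a) + (gap (isZero b) + (gap (isZero c) + n)))
            (kunz-genus M (a ∸ 1) (b ∸ 1) (c ∸ 1) (∸-monoˡ-≤ 1 a≤) (∸-monoˡ-≤ 1 b≤) (∸-monoˡ-≤ 1 c≤)) ⟩
  gap (isZero a) + (gap (isZero b) + (gap (isZero c) + ((a ∸ 1) + (b ∸ 1) + (c ∸ 1))))
    ≡⟨ regroup (gap (isZero a)) (gap (isZero b)) (gap (isZero c)) (a ∸ 1) (b ∸ 1) (c ∸ 1) ⟩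
  gap (isZero a) + (a ∸ 1) + (gap (isZero b) + (b ∸ 1)) + (gap (isZero c) + (c ∸ 1))
    ≡⟨ cong₂ _+_ (cong₂ _+_ (gap-isZero a) (gap-isZero b)) (gap-isZero c) ⟩
  a + b + c ∎
  where
  open ≡-Reasoning
  K K′ : Subset
  K  = kunz a b c
  K′ = kunz (a ∸ 1) (b ∸ 1) (c ∸ 1)
  first-block : gapsBelow K (4 + M * 4) ≡ gap (isZero a) + (gap (isZero b) + (gap (isZero c) + gapsBelow K′ (M * 4)))
  first-block =
    trans (gapsBelow-front K (3 + M * 4)) (trans (gapsBelow-front (λ n → K (1 + n)) (2 + M * 4))
      (cong (gap (isZero a) +_) (trans (gapsBelow-front (λ n → K (2 + n)) (1 + M * 4))
        (cong (gap (isZero b) +_) (gapsBelow-front (λ n → K (3 + n)) (M * 4))))))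
  regroup : ∀ x y z p q r → x + (y + (z + (p + q + r))) ≡ x + p + (y + q) + (z + r)
  regroup = solve-∀

-- The sum M = a + b + c bounds every coordinate, so 4M bounds all gaps of kunz a b c.
module _ (a b c : ℕ) where
  private
    M = a + b + c
    a≤M : a ≤ M
    a≤M = ≤-trans (m≤m+n a b) (m≤m+n (a + b) c)
    b≤M : b ≤ M
    b≤M = ≤-trans (m≤n+m b a) (m≤m+n (a + b) c)
    c≤M : c ≤ M
    c≤M = m≤n+m c (a + b)

  kunz-cofinite : ∀ n → (a + b + c) * 4 ≤ n → kunz a b c n ≡ true
  kunz-cofinite = kunz-full M a≤M b≤M c≤M

  kunz-gaps : gapsBelow (kunz a b c) ((a + b + c) * 4) ≡ a + b + c
  kunz-gaps = kunz-genus M a b c a≤M b≤M c≤M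

KunzCoords : ℕ → ℕ × ℕ × ℕ → Set
KunzCoords g (a , b , c) = (1 ≤ a) × (1 ≤ b) × (1 ≤ c) × (a + b + c ≡ g) × KunzIneqs a b c

kunzSet : ℕ × ℕ × ℕ → Subset
kunzSet (a , b , c) = kunz a b c

kunz-NSm4 : ∀ {g} k → KunzCoords g k → NSm4 g (kunzSet k)
kunz-NSm4 (a , b , c) (1≤a , 1≤b , 1≤c , sum≡g , b≤2a , b≤2c+1 , c≤a+b , a≤b+c+1) =
  record { zero∈    = refl
         ; closed   = Sufficiency.closed b≤2a b≤2c+1 c≤a+b a≤b+c+1
         ; cofinite = (a + b + c) * 4 , kunz-cofinite a b c }
  , kunz-multiplicity 1≤a 1≤b 1≤c
  , (a + b + c) * 4 , kunz-cofinite a b c , trans (kunz-gaps a b c) sum≡g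

-- The coordinates are read off from the set: 4 · coord r + r is its least
-- element congruent to r mod 4.
kunz-injective : ∀ k k′ → kunzSet k ≐ kunzSet k′ → k ≡ k′
kunz-injective (a , b , c) (a′ , b′ , c′) k≐k′ =
  cong₂ _,_ (same-coord 1 (s≤s z≤n)) (cong₂ _,_ (same-coord 2 (s≤s (s≤s z≤n))) (same-coord 3 ≤-refl))
  where
  coord-≤ : ∀ {a b c a′ b′ c′} r → r ≤ 3 → kunz a b c ≐ kunz a′ b′ c′ → coord a′ b′ c′ r ≤ coord a b c r
  coord-≤ {a} {b} {c} r r≤3 eq =
    ∈kunz⁻¹ (coord a b c r) r≤3 (trans (sym (eq (coord a b c r * 4 + r))) (∈kunz (coord a b c r) r≤3 ≤-refl))
  same-coord : ∀ r → r ≤ 3 → coord a b c r ≡ coord a′ b′ c′ r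
  same-coord r r≤3 = ≤-antisym (coord-≤ r r≤3 (λ n → sym (k≐k′ n))) (coord-≤ r r≤3 k≐k′)

-- Every multiplicity-4 semigroup of genus g is kunz a b c, where 4a + 1,
-- 4b + 2, 4c + 3 are its least elements in the nonzero residue classes.
module FromSemigroup {g : ℕ} {S : Subset} (ns : IsNumericalSemigroup S)
                     (mult : HasMultiplicity S 4) (genus : HasGenus S g) where
  open IsNumericalSemigroup ns

  multiples-of-4 : ∀ q → S (q * 4) ≡ true
  multiples-of-4 zero    = zero∈
  multiples-of-4 (suc q) = closed 4 (q * 4) (proj₁ (proj₂ mult)) (multiples-of-4 q)

  apéry : ∀ r → Σ ℕ λ m → S (m * 4 + r) ≡ true × (∀ q → q < m → S (q * 4 + r) ≢ true)
  apéry r = least (λ q → S (q * 4 + r) ≡ true) (λ q → S (q * 4 + r) Bool.≟ true) {N}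
                  (full (N * 4 + r) (≤-trans (m≤m*n N 4) (m≤m+n (N * 4) r)))
    where
    N = proj₁ cofinite
    full = proj₂ cofinite

  -- From its Apéry element on, a residue class lies in S (add multiples of 4).
  residue-class : ∀ r q → S (q * 4 + r) ≡ isZero (proj₁ (apéry r) ∸ q)
  residue-class r q with apéry r
  ... | m , m∈S , below with m ≤? q
  ...   | yes m≤q = trans (cong S shifted) (trans (closed _ _ (multiples-of-4 (q ∸ m)) m∈S) (sym (isZero-∸ m≤q)))
    where
    shifted : q * 4 + r ≡ (q ∸ m) * 4 + (m * 4 + r)
    shifted = begin
      q * 4 + r                   ≡⟨ cong (λ n → n * 4 + r) (sym (m∸n+n≡m m≤q)) ⟩
      (q ∸ m + m) * 4 + r         ≡⟨ cong (_+ r) (*-distribʳ-+ 4 (q ∸ m) m) ⟩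
      (q ∸ m) * 4 + m * 4 + r     ≡⟨ +-assoc ((q ∸ m) * 4) (m * 4) r ⟩
      (q ∸ m) * 4 + (m * 4 + r)   ∎
      where open ≡-Reasoning
  ...   | no m≰q = trans (¬-not (below q (≰⇒> m≰q))) (sym (isZero-∸> (≰⇒> m≰q)))

  a b c : ℕ
  a = proj₁ (apéry 1)
  b = proj₁ (apéry 2)
  c = proj₁ (apéry 3)

  S≐kunz : S ≐ kunz a b c
  S≐kunz n with divMod4 n
  ... | q , r , r≤3 , refl = trans (class r r≤3) (sym (kunz-residue a b c q r r≤3))
    where
    class : ∀ r → r ≤ 3 → S (q * 4 + r) ≡ isZero (coord a b c r ∸ q)
    class 0 _ rewrite +-identityʳ (q * 4) | 0∸n≡0 q = multiples-of-4 q
    class 1 _ = residue-class 1 q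
    class 2 _ = residue-class 2 q
    class 3 _ = residue-class 3 q
    class (suc (suc (suc (suc _)))) (s≤s (s≤s (s≤s ())))

  -- 1, 2, 3 ∉ S, so every Apéry coordinate is positive.
  positive : ∀ r → 1 ≤ r → r ≤ 3 → 1 ≤ proj₁ (apéry r)
  positive r 1≤r r≤3 with apéry r
  ... | zero  , r∈S , _ = contradiction (trans (sym r∈S) r∉S) λ ()
    where
    r∉S : S r ≡ false
    r∉S = proj₂ (proj₂ mult) r (λ { refl → <⇒≱ 1≤r z≤n }) (m≤n⇒m≤1+n r≤3) (λ { refl → <⇒≱ r≤3 ≤-refl })
  ... | suc _ , _ = s≤s z≤n

  sum≡genus : a + b + c ≡ g
  sum≡genus = trans (sym (kunz-gaps a b c))
                    (genus-unique ((a + b + c) * 4) (kunz-cofinite a b c) (HasGenus-cong S≐kunz genus))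

  coords : KunzCoords g (a , b , c)
  coords = positive 1 ≤-refl (s≤s z≤n) , positive 2 (s≤s z≤n) (s≤s (s≤s z≤n)) , positive 3 (s≤s z≤n) ≤-refl
         , sum≡genus , Necessity.ineqs (closed-cong S≐kunz closed)

semigroup-kunz : ∀ {g S} → NSm4 g S → Σ (ℕ × ℕ × ℕ) λ k → KunzCoords g k × kunzSet k ≐ S
semigroup-kunz (ns , mult , genus) =
  (a , b , c) , coords , λ n → sym (S≐kunz n)
  where open FromSemigroup ns mult genus

record LowerBound (b s L : ℕ) : Set where
  constructor lowerBound
  field
    b≤2L   : b ≤ L + L
    s≤2L+b : s ≤ L + L + b

-- The least such bound, L = max(⌈b/2⌉, ⌈(s − b)/2⌉): one of the two bounds
-- fails for L − 1.
record IsLeastBound (b s L : ℕ) : Set where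
  constructor leastBound
  field
    bound : LowerBound b s L
    tight : (L + L ≤ b + 1) ⊎ (L + L + b ≤ s + 1)

least-bound-minimal : ∀ {b s L L′} → IsLeastBound b s L → LowerBound b s L′ → L ≤ L′
least-bound-minimal {b} {s} {L} {L′} (leastBound _ (inj₁ 2L≤b+1)) (lowerBound b≤2L′ _) =
  half-≤ L L′ (linear (2L≤b+1 ⊕ b≤2L′) (solve (b ∷ L ∷ L′ ∷ [])))
least-bound-minimal {b} {s} {L} {L′} (leastBound _ (inj₂ 2L+b≤s+1)) (lowerBound _ s≤2L′+b) =
  half-≤ L L′ (linear (2L+b≤s+1 ⊕ s≤2L′+b) (solve (b ∷ s ∷ L ∷ L′ ∷ [])))

least-bound-unique : ∀ {b s L L′} → IsLeastBound b s L → IsLeastBound b s L′ → L ≡ L′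
least-bound-unique lb lb′ =
  ≤-antisym (least-bound-minimal lb (IsLeastBound.bound lb′)) (least-bound-minimal lb′ (IsLeastBound.bound lb))

least-bound-exists : ∀ b s → Σ ℕ (IsLeastBound b s)
least-bound-exists b s with least (LowerBound b s) bound? {b + s} (lowerBound b≤ s≤)
  where
  bound? : ∀ L → Dec (LowerBound b s L)
  bound? L = map′ (λ (p , q) → lowerBound p q) (λ (lowerBound p q) → p , q) ((b ≤? L + L) ×-dec (s ≤? L + L + b))
  b≤ : b ≤ b + s + (b + s)
  b≤ = linear (z≤n {b + s + s}) (solve (b ∷ s ∷ []))
  s≤ : s ≤ b + s + (b + s) + b
  s≤ = linear (z≤n {b + b + b + s}) (solve (b ∷ s ∷ []))
... | zero  , bound , _ = 0 , leastBound bound (inj₁ z≤n)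
... | suc L , bound , below with b ≤? L + L
...   | yes b≤2L = suc L , leastBound bound (inj₂ (linear (<⇒1+≤ (≰⇒> s≰)) (solve (b ∷ s ∷ L ∷ []))))
  where
  s≰ : s ≰ L + L + b
  s≰ s≤ = below L ≤-refl (lowerBound b≤2L s≤)
...   | no b≰2L = suc L , leastBound bound (inj₁ (linear (<⇒1+≤ (≰⇒> b≰2L)) (solve (b ∷ L ∷ []))))

-- The triple (x, y, z) attached to Kunz coordinates (a, b, c): with L the least
-- bound for b and a + c, it is (a − L + 2, b + 2, L + c + 2).  Equivalently
-- x = 2 + ⌊min(a + b − c, 2a − b)/2⌋.
Corresponds : ℕ × ℕ × ℕ → ℕ × ℕ × ℕ → Set
Corresponds (a , b , c) (x , y , z) = Σ ℕ λ x′ → Σ ℕ λ L →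
  (a ≡ x′ + L) × (x ≡ x′ + 2) × (y ≡ b + 2) × (z ≡ L + c + 2) × IsLeastBound b (a + c) L

corresponds-functional : ∀ {k t u} → Corresponds k t → Corresponds k u → t ≡ u
corresponds-functional (x′ , L , refl , refl , refl , refl , lb) (x″ , L′ , a≡ , refl , refl , refl , lb′)
  with least-bound-unique lb lb′
... | refl with +-cancelʳ-≡ L x′ x″ a≡
... | refl = refl

-- ... and a triple to at most one Kunz triple: x, y and z determine x′, b
-- and L + c, hence the sum a + c = x′ + (L + c), hence L.
corresponds-injective : ∀ {k k′ t} → Corresponds k t → Corresponds k′ t → k ≡ k′
corresponds-injective {_ , b , c} {_ , b′ , c′}
  (x′ , L , refl , refl , refl , refl , lb) (x″ , L′ , refl , x≡ , y≡ , z≡ , lb′)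
  with +-cancelʳ-≡ 2 x′ x″ x≡ | +-cancelʳ-≡ 2 b b′ y≡
... | refl | refl with least-bound-unique lb (subst (λ s → IsLeastBound b s L′) same-sum lb′)
  where
  same-sum : x′ + L′ + c′ ≡ x′ + L + c
  same-sum = trans (+-assoc x′ L′ c′) (trans (cong (x′ +_) (sym (+-cancelʳ-≡ 2 (L + c) (L′ + c′) z≡)))
                                             (sym (+-assoc x′ L c)))
... | refl with +-cancelˡ-≡ L c c′ (+-cancelʳ-≡ 2 (L + c) (L + c′) z≡)
... | refl = refl

good-triple : ∀ {n x y z} → 2 ≤ x → 3 ≤ y → 4 ≤ z → x ≤ y → y ≤ z → x + y + z ≡ n →
              GoodTriple n (x , y , z)
good-triple 2≤x 3≤y 4≤z x≤y y≤z sum =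
  ≤-trans (s≤s z≤n) 2≤x , x≤y , y≤z , sum
  , (λ x≡1 → <⇒≢ 2≤x (sym x≡1)) , (λ y≡2 → <⇒≢ 3≤y (sym y≡2)) , (λ z≡3 → <⇒≢ 4≤z (sym z≡3))

good-triple-bounds : ∀ {n x y z} → GoodTriple n (x , y , z) → (2 ≤ x) × (3 ≤ y) × (4 ≤ z)
good-triple-bounds (1≤x , x≤y , y≤z , _ , x≢1 , y≢2 , z≢3) = 2≤x , 3≤y , 4≤z
  where
  2≤x = ≤∧≢⇒< 1≤x (λ 1≡x → x≢1 (sym 1≡x))
  3≤y = ≤∧≢⇒< (≤-trans 2≤x x≤y) (λ 2≡y → y≢2 (sym 2≡y))
  4≤z = ≤∧≢⇒< (≤-trans 3≤y y≤z) (λ 3≡z → z≢3 (sym 3≡z))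

toTriple : ∀ {g} k → KunzCoords g k → Σ (ℕ × ℕ × ℕ) λ t → GoodTriple (g + 6) t × Corresponds k t
toTriple {g} (a , b , c) (1≤a , 1≤b , 1≤c , sum≡g , b≤2a , b≤2c+1 , c≤a+b , a≤b+c+1)
  with least-bound-exists b (a + c)
... | L , lb@(leastBound (lowerBound b≤2L a+c≤2L+b) _) with ∃-difference (least-bound-minimal {L′ = a} lb (lowerBound b≤2a a+c≤2a+b))
  where
  a+c≤2a+b : a + c ≤ a + a + b
  a+c≤2a+b = linear c≤a+b (solve (a ∷ b ∷ c ∷ []))
... | x′ , refl = (x′ + 2 , b + 2 , L + c + 2) , good , x′ , L , refl , refl , refl , refl , lb
  where
  x′≤b : x′ ≤ b
  x′≤b = half-≤ x′ b (linear (a+c≤2L+b ⊕ a≤b+c+1) (solve (x′ ∷ L ∷ b ∷ c ∷ [])))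
  b≤L+c : b ≤ L + c
  b≤L+c = half-≤ b (L + c) (linear (b≤2L ⊕ b≤2c+1) (solve (L ∷ b ∷ c ∷ [])))
  sum : x′ + 2 + (b + 2) + (L + c + 2) ≡ g + 6
  sum = begin
    x′ + 2 + (b + 2) + (L + c + 2) ≡⟨ solve (x′ ∷ L ∷ b ∷ c ∷ []) ⟩
    x′ + L + b + c + 6             ≡⟨ cong (_+ 6) sum≡g ⟩
    g + 6                          ∎
    where open ≡-Reasoning
  good : GoodTriple (g + 6) (x′ + 2 , b + 2 , L + c + 2)
  good = good-triple (m≤n+m 2 x′) (1≤b ⊕ ≤-refl) ((half-positive 1≤b b≤2L ⊕ 1≤c) ⊕ ≤-refl)
                     (x′≤b ⊕ ≤-refl) (b≤L+c ⊕ ≤-refl) sum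

-- Writing
-- the triple as (x′ + 2, b + 2, u + 3), take L the least bound for b and
-- x′ + u + 1; then L ≤ u, and with u = c′ + L the Kunz triple is (x′ + L, b, c′ + 1).
toKunz : ∀ {g} t → GoodTriple (g + 6) t → Σ (ℕ × ℕ × ℕ) λ k → KunzCoords g k × Corresponds k t
toKunz {g} (x , y , z) good@(_ , x≤y , y≤z , sum , _) with good-triple-bounds good
... | 2≤x , 3≤y , 4≤z
  with ∃-difference 2≤x | ∃-difference (≤-trans (n≤1+n 2) 3≤y) | ∃-difference (≤-trans (n≤1+n 3) 4≤z)
... | x′ , refl | b , refl | u , refl with least-bound-exists b (x′ + u + 1)
... | L , lb@(leastBound (lowerBound b≤2L s≤2L+b) tight)
  with ∃-difference (least-bound-minimal {L′ = u} lb (lowerBound b≤2u s≤2u+b))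
  where
  1≤u : 1 ≤ u
  1≤u = +-cancelʳ-≤ 3 1 u 4≤z
  b≤2u : b ≤ u + u
  b≤2u = linear (y≤z ⊕ 1≤u) (solve (b ∷ u ∷ []))
  s≤2u+b : x′ + u + 1 ≤ u + u + b
  s≤2u+b = linear (x≤y ⊕ 1≤u) (solve (x′ ∷ b ∷ u ∷ []))
... | c′ , refl = (x′ + L , b , c′ + 1) , coords , x′ , L , refl , refl , refl , z≡ , lb′
  where
  1≤b : 1 ≤ b
  1≤b = +-cancelʳ-≤ 2 1 b 3≤y
  -- The two Kunz inequalities that depend on which bound is tight at L.
  tight-ineqs : (L + L ≤ b + 1) ⊎ (L + L + b ≤ x′ + (c′ + L) + 1 + 1) →
                (b ≤ c′ + 1 + (c′ + 1) + 1) × (x′ + L ≤ b + (c′ + 1) + 1)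
  tight-ineqs (inj₁ 2L≤b+1) = linear (y≤z ⊕ y≤z ⊕ 2L≤b+1) (solve (x′ ∷ L ∷ b ∷ c′ ∷ []))
                            , linear (x≤y ⊕ y≤z ⊕ 2L≤b+1) (solve (x′ ∷ L ∷ b ∷ c′ ∷ []))
  tight-ineqs (inj₂ 2L+b≤s+1) = linear (2L+b≤s+1 ⊕ x≤y ⊕ y≤z) (solve (x′ ∷ L ∷ b ∷ c′ ∷ []))
                               , linear (2L+b≤s+1 ⊕ x≤y ⊕ x≤y) (solve (x′ ∷ L ∷ b ∷ c′ ∷ []))
  sum≡g : x′ + L + b + (c′ + 1) ≡ g
  sum≡g = +-cancelʳ-≡ 6 (x′ + L + b + (c′ + 1)) g (begin
    x′ + L + b + (c′ + 1) + 6        ≡⟨ solve (x′ ∷ L ∷ b ∷ c′ ∷ []) ⟩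
    x′ + 2 + (b + 2) + (c′ + L + 3)  ≡⟨ sum ⟩
    g + 6                            ∎)
    where open ≡-Reasoning
  coords : KunzCoords g (x′ + L , b , c′ + 1)
  coords = ≤-trans (half-positive 1≤b b≤2L) (m≤n+m L x′) , 1≤b , m≤n+m 1 c′ , sum≡g
         , linear (b≤2L ⊕ z≤n {x′ + x′}) (solve (x′ ∷ L ∷ b ∷ []))
         , proj₁ (tight-ineqs tight)
         , linear (s≤2L+b ⊕ z≤n {x′ + x′}) (solve (x′ ∷ L ∷ b ∷ c′ ∷ []))
         , proj₂ (tight-ineqs tight)
  z≡ : c′ + L + 3 ≡ L + (c′ + 1) + 2
  z≡ = solve (L ∷ c′ ∷ [])
  lb′ : IsLeastBound b (x′ + L + (c′ + 1)) L
  lb′ = subst (λ s → IsLeastBound b s L) same-sum lb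
    where
    same-sum : x′ + (c′ + L) + 1 ≡ x′ + L + (c′ + 1)
    same-sum = solve (x′ ∷ L ∷ c′ ∷ [])

-- A relation R between Q-elements of B and P-elements of A that is total and
-- single-valued in both directions is the graph of a bijection P ≅ Q; when P is
-- decidable the bijection extends to a function on all of A.
module RelationBijection {A B : Set} (P : A → Set) (Q : B → Set) (R : B → A → Set)
  (P? : ∀ u → Dec (P u)) (default : B)
  (total-P : ∀ u → P u → Σ B λ v → Q v × R v u)
  (total-Q : ∀ v → Q v → Σ A λ u → P u × R v u)
  (functional : ∀ {v u u′} → R v u → R v u′ → u ≡ u′)
  (injective : ∀ {v v′ u} → R v u → R v′ u → v ≡ v′) where

  -- σ is opaque: only its specification σ-related is ever needed, and
  -- unfolding it would make the type checker evaluate the arithmetic witnesses.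
  opaque
    σ : A → B
    σ u with P? u
    ... | yes Pu = proj₁ (total-P u Pu)
    ... | no  _  = default

    σ-related : ∀ u → P u → Q (σ u) × R (σ u) u
    σ-related u Pu with P? u
    ... | yes Pu′ = proj₂ (total-P u Pu′)
    ... | no ¬Pu  = contradiction Pu ¬Pu

  σ-injective : ∀ u u′ → P u → P u′ → σ u ≡ σ u′ → u ≡ u′
  σ-injective u u′ Pu Pu′ σu≡σu′ =
    functional (proj₂ (σ-related u Pu)) (subst (λ v → R v u′) (sym σu≡σu′) (proj₂ (σ-related u′ Pu′)))

  σ-onto : ∀ v → Q v → Σ A λ u → P u × σ u ≡ v
  σ-onto v Qv with total-Q v Qv
  ... | u , Pu , Rvu = u , Pu , injective (proj₂ (σ-related u Pu)) Rvu

good? : ∀ n t → Dec (GoodTriple n t)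
good? n (x , y , z) = (1 ≤? x) ×-dec (x ≤? y) ×-dec (y ≤? z) ×-dec (x + y + z ≟ n)
                      ×-dec ¬? (x ≟ 1) ×-dec ¬? (y ≟ 2) ×-dec ¬? (z ≟ 3)

corollary3p7 : (g : ℕ) →
    Σ ((ℕ × ℕ × ℕ) → Subset) λ f →
      (∀ t → GoodTriple (g + 6) t → NSm4 g (f t))
      × (∀ t u → GoodTriple (g + 6) t → GoodTriple (g + 6) u → f t ≐ f u → t ≡ u)
      × (∀ S → NSm4 g S → ∃ λ t → GoodTriple (g + 6) t × f t ≐ S)
corollary3p7 g = f , f-NSm4 , f-injective , f-onto
  where
  open RelationBijection (GoodTriple (g + 6)) (KunzCoords g) Corresponds (good? (g + 6)) (0 , 0 , 0)
                         toKunz toTriple corresponds-functional corresponds-injective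

  f : ℕ × ℕ × ℕ → Subset
  f t = kunzSet (σ t)

  f-NSm4 : ∀ t → GoodTriple (g + 6) t → NSm4 g (f t)
  f-NSm4 t good = kunz-NSm4 (σ t) (proj₁ (σ-related t good))

  f-injective : ∀ t u → GoodTriple (g + 6) t → GoodTriple (g + 6) u → f t ≐ f u → t ≡ u
  f-injective t u good-t good-u ft≐fu = σ-injective t u good-t good-u (kunz-injective (σ t) (σ u) ft≐fu)

  f-onto : ∀ S → NSm4 g S → ∃ λ t → GoodTriple (g + 6) t × f t ≐ S
  f-onto S ns =
    let (k , coords , k≐S) = semigroup-kunz ns
        (t , good , σt≡k)  = σ-onto k coords
    in  t , good , λ n → trans (cong (λ k′ → kunzSet k′ n) σt≡k) (k≐S n)
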